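{- Let $G$ be a split graph with a fixed partition of $V(G)$ into a clique $C(G)$ and an independent set $I(G)$, and let $P$ be the characteristic poset of $G$. Then $\dim(P)\le 2\,\mathrm{box}(G)$.
   Context: All graphs are finite, simple and undirected; $N(u,G)$ is the neighbourhood of $u$ in $G$. A split graph is a graph whose vertex set can be partitioned into a clique and an independent set. The characteristic poset of $G$ is $P=(\{N(u,G):u\in I(G)\},\subseteq)$, the set of neighbourhoods of independent-set vertices ordered by inclusion. For a poset $P$, $\dim(P)$ is the minimum number of linear extensions of $P$ such that for every incomparable pair $x,y$ some extension has $x$ before $y$ and some has $y$ before $x$. The boxicity $\mathrm{box}(G)$ is the minimum $k$ such that $G$ is the intersection graph of $k$-dimensional axis-parallel boxes; equivalently the minimum $k$ such that $G$ is the intersection (on the common vertex set, intersecting edge sets) of $k$ interval graphs. -}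

module Defs where

open import Data.Nat using (ℕ; _≤_; _<_)
open import Data.Fin using (Fin)
open import Data.Bool using (Bool; true; false)
open import Data.Product using (Σ; ∃; _×_)
open import Relation.Nullary using (¬_)
open import Relation.Binary.PropositionalEquality using (_≡_; _≢_)

record Graph (n : ℕ) : Set₁ where
  field
    Adj     : Fin n → Fin n → Set
    sym     : ∀ {u v} → Adj u v → Adj v u
    irrefl  : ∀ {u} → ¬ Adj u u
open Graph public

_⊆N_within_ : ∀ {n} → Fin n → Fin n → Graph n → Set
u ⊆N v within G = ∀ w → Adj G u w → Adj G v w

-- A fixed partition of V(G) into a clique C(G) (inC u ≡ true)
-- and an independent set I(G) (inC u ≡ false).
record IsSplitPartition {n : ℕ} (G : Graph n) (inC : Fin n → Bool) : Set where
  field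
    clique      : ∀ u v → u ≢ v → inC u ≡ true → inC v ≡ true → Adj G u v
    independent : ∀ u v → inC u ≡ false → inC v ≡ false → ¬ Adj G u v

-- Interval graph: closed intervals [l u, r u] (integer endpoints),
-- adjacency of distinct vertices iff the intervals intersect.
IsIntervalGraph : ∀ {n} → Graph n → Set
IsIntervalGraph {n} H =
  Σ (Fin n → ℕ) λ l → Σ (Fin n → ℕ) λ r →
    (∀ u → l u ≤ r u) ×
    (∀ u v → u ≢ v → (Adj H u v → (l u ≤ r v × l v ≤ r u))
                     × ((l u ≤ r v × l v ≤ r u) → Adj H u v))

BoxicityAtMost : ∀ {n} → Graph n → ℕ → Set₁
BoxicityAtMost {n} G k =
  Σ ℕ λ j → j ≤ k × Σ (Fin j → Graph n) λ H →
    (∀ i → IsIntervalGraph (H i)) ×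
    (∀ u v → (Adj G u v → ∀ i → Adj (H i) u v)
           × ((∀ i → Adj (H i) u v) → Adj G u v))

-- A linear extension of the characteristic poset
-- P = ({N(u,G) : u ∈ I(G)}, ⊆), encoded as a rank function on I(G):
-- the element N(u) is placed at position f u. Equal neighbourhoods get
-- equal ranks, equal ranks mean equal neighbourhoods (so this is a total
-- order on the elements of P), and inclusion is respected.
IsLinearExtension : ∀ {n} → (G : Graph n) → (Fin n → Bool) → (Fin n → ℕ) → Set
IsLinearExtension G inC f =
  ∀ u v → inC u ≡ false → inC v ≡ false →
    (u ⊆N v within G → f u ≤ f v) × (f u ≡ f v → u ⊆N v within G)

DimAtMost : ∀ {n} → (G : Graph n) → (Fin n → Bool) → ℕ → Set
DimAtMost {n} G inC m =
  Σ ℕ λ j → j ≤ m × Σ (Fin j → Fin n → ℕ) λ L →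
    (∀ i → IsLinearExtension G inC (L i)) ×
    (∀ u v → inC u ≡ false → inC v ≡ false →
       ¬ (u ⊆N v within G) → ¬ (v ⊆N u within G) →
       (∃ λ i → L i u < L i v) × (∃ λ i → L i v < L i u))

module Submission where

-- Let G be the intersection of interval graphs H₁ … H_j, where
-- vertex w of H_i is the interval [left i w , right i w].  For a weight φ on
-- the vertices let  reach φ u  be the largest weight of a neighbour of u.  It
-- is monotone under inclusion of neighbourhoods, so it ranks the
-- characteristic poset compatibly with ⊆; breaking ties by a binary encoding
-- of the neighbourhood turns each such ranking into a linear extension.
-- Each H_i contributes two rankings: reach by left endpoints, and reach by
-- left endpoints of the mirrored intervals (the line read backwards).
-- If u, v are independent and N(u) ⊈ N(v), pick c ∈ N(u) ∖ N(v); some H_i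
-- separates the intervals of v and c.  If c lies to the right of v, every
-- neighbour of v starts before right i v < left i c, so the first ranking puts
-- v strictly below u; if c lies to the left, the mirrored ranking does.
-- Hence these 2j ≤ 2k linear extensions form a realizer.

open import Defs
open import Data.Nat using (ℕ; _*_)
open import Data.Fin using (Fin)
open import Data.Bool using (Bool)

open import Data.Nat using (zero; suc; _+_; _∸_; _≤_; _<_; _⊔_; z≤n; s≤s; _≤?_)
open import Data.Nat.Properties
open import Data.Fin using (zero; suc; remQuot; combine)
open import Data.Fin.Properties using (any?; all?; ¬∀⟶∃¬; remQuot-combine)
  renaming (_≟_ to _≟ᶠ_)
open import Data.Bool using (true; false; T; if_then_else_)
open import Data.Unit using (tt)
open import Data.Product using (∃; _×_; _,_; proj₁; proj₂)
open import Data.Sum using (_⊎_; inj₁; inj₂)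
open import Function using (_∘_)
open import Relation.Nullary using (¬_; Dec; yes; no; does; contradiction)
open import Relation.Nullary.Decidable using (_×-dec_; ¬?; isYes; toWitness; fromWitness)
open import Relation.Binary using (Decidable; tri<; tri≈; tri>)
open import Relation.Binary.PropositionalEquality
  using (_≡_; _≢_; refl; subst) renaming (sym to ≡-sym)

maxOf : ∀ {m} → (Fin m → ℕ) → ℕ
maxOf {zero}  f = 0
maxOf {suc m} f = f zero ⊔ maxOf (f ∘ suc)

≤-maxOf : ∀ {m} (f : Fin m → ℕ) x → f x ≤ maxOf f
≤-maxOf f zero    = m≤m⊔n _ _
≤-maxOf f (suc x) = ≤-trans (≤-maxOf (f ∘ suc) x) (m≤n⊔m (f zero) _)

maxOf-lub : ∀ {m} (f : Fin m → ℕ) {b} → (∀ x → f x ≤ b) → maxOf f ≤ b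
maxOf-lub {zero}  f bound = z≤n
maxOf-lub {suc m} f bound = ⊔-lub (bound zero) (maxOf-lub (f ∘ suc) (bound ∘ suc))

maxOf-mono : ∀ {m} (f g : Fin m → ℕ) → (∀ x → f x ≤ g x) → maxOf f ≤ maxOf g
maxOf-mono f g f≤g = maxOf-lub f (λ x → ≤-trans (f≤g x) (≤-maxOf g x))

bitValue : Bool → ℕ
bitValue false = 0
bitValue true  = 1

encode : ∀ {m} → (Fin m → Bool) → ℕ
encode {zero}  b = 0
encode {suc m} b = bitValue (b zero) + 2 * encode (b ∘ suc)

_⊆ᵇ_ : ∀ {m} → (Fin m → Bool) → (Fin m → Bool) → Set
b ⊆ᵇ c = ∀ x → T (b x) → T (c x)

bitValue-mono : ∀ p q → (T p → T q) → bitValue p ≤ bitValue q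
bitValue-mono false q       p⇒q = z≤n
bitValue-mono true  true    p⇒q = ≤-refl
bitValue-mono true  false   p⇒q = contradiction tt p⇒q

encode-mono : ∀ {m} (b c : Fin m → Bool) → b ⊆ᵇ c → encode b ≤ encode c
encode-mono {zero}  b c b⊆c = z≤n
encode-mono {suc m} b c b⊆c =
  +-mono-≤ (bitValue-mono (b zero) (c zero) (b⊆c zero))
           (*-monoʳ-≤ 2 (encode-mono (b ∘ suc) (c ∘ suc) (b⊆c ∘ suc)))

digits-unique : ∀ p q a c → bitValue p + 2 * a ≡ bitValue q + 2 * c → p ≡ q × a ≡ c
digits-unique false false a c eq = refl , *-cancelˡ-≡ a c 2 eq
digits-unique true  true  a c eq = refl , *-cancelˡ-≡ a c 2 (suc-injective eq)
digits-unique false true  a c eq = contradiction eq (even≢odd a c)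
digits-unique true  false a c eq = contradiction (≡-sym eq) (even≢odd c a)

encode-injective : ∀ {m} (b c : Fin m → Bool) → encode b ≡ encode c → ∀ x → b x ≡ c x
encode-injective {suc m} b c eq x
  with digits-unique (b zero) (c zero) (encode (b ∘ suc)) (encode (c ∘ suc)) eq
encode-injective {suc m} b c eq zero    | same-digit , _ = same-digit
encode-injective {suc m} b c eq (suc x) | _ , same-rest  =
  encode-injective (b ∘ suc) (c ∘ suc) same-rest x

module Neighbourhoods {n} (G : Graph n) (adj? : Decidable (Adj G)) where

  missedNeighbour : ∀ u v → ¬ (u ⊆N v within G) → ∃ λ c → Adj G u c × ¬ Adj G v c
  missedNeighbour u v u⊈v with any? (λ w → adj? u w ×-dec ¬? (adj? v w))
  ... | yes found = found
  ... | no none   = contradiction u⊆v u⊈v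
    where
      u⊆v : u ⊆N v within G
      u⊆v w a with adj? v w
      ... | yes b  = b
      ... | no ¬b  = contradiction (w , a , ¬b) none

  onNeighbours : (Fin n → ℕ) → Fin n → Fin n → ℕ
  onNeighbours φ u w = if does (adj? u w) then φ w else 0

  reach : (Fin n → ℕ) → Fin n → ℕ
  reach φ u = maxOf (onNeighbours φ u)

  reach-mono : ∀ φ {u v} → u ⊆N v within G → reach φ u ≤ reach φ v
  reach-mono φ {u} {v} u⊆v = maxOf-mono _ _ pointwise
    where
      pointwise : ∀ w → onNeighbours φ u w ≤ onNeighbours φ v w
      pointwise w with adj? u w | adj? v w
      ... | yes a | yes _  = ≤-refl
      ... | yes a | no ¬b  = contradiction (u⊆v w a) ¬b
      ... | no _  | _      = z≤n

  reach-separates : ∀ φ {u v c b} → Adj G u c → (∀ w → Adj G v w → φ w ≤ b) →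
                    b < φ c → reach φ v < reach φ u
  reach-separates φ {u} {v} {c} {b} uc bound b<φc = begin-strict
      reach φ v              ≤⟨ maxOf-lub (onNeighbours φ v) bounded ⟩
      b                      <⟨ b<φc ⟩
      φ c                    ≡⟨ ≡-sym restricted ⟩
      onNeighbours φ u c     ≤⟨ ≤-maxOf (onNeighbours φ u) c ⟩
      reach φ u              ∎
    where
      open ≤-Reasoning
      bounded : ∀ w → onNeighbours φ v w ≤ b
      bounded w with adj? v w
      ... | yes a = bound w a
      ... | no _  = z≤n
      restricted : onNeighbours φ u c ≡ φ c
      restricted with adj? u c
      ... | yes _  = refl
      ... | no ¬a  = contradiction uc ¬a

  nbhd : Fin n → Fin n → Bool
  nbhd u w = isYes (adj? u w)

  code : Fin n → ℕ
  code u = encode (nbhd u)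

  codeBound : ℕ
  codeBound = suc (encode {n} (λ _ → true))

  code<codeBound : ∀ u → code u < codeBound
  code<codeBound u = s≤s (encode-mono (nbhd u) (λ _ → true) (λ _ _ → tt))

  code-mono : ∀ u v → u ⊆N v within G → code u ≤ code v
  code-mono u v u⊆v = encode-mono (nbhd u) (nbhd v)
    (λ w t → fromWitness {a? = adj? v w} (u⊆v w (toWitness {a? = adj? u w} t)))

  code-injective : ∀ u v → code u ≡ code v → u ⊆N v within G
  code-injective u v eq w a = toWitness {a? = adj? v w}
    (subst T (encode-injective (nbhd u) (nbhd v) eq w) (fromWitness {a? = adj? u w} a))

  -- The ranking g with ties broken by the code of the neighbourhood.
  refine : (Fin n → ℕ) → Fin n → ℕ
  refine g u = g u * codeBound + code u

  refine-strict : ∀ g u v → g u < g v → refine g u < refine g v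
  refine-strict g u v gu<gv = begin-strict
      g u * codeBound + code u     <⟨ +-monoʳ-< (g u * codeBound) (code<codeBound u) ⟩
      g u * codeBound + codeBound  ≡⟨ +-comm (g u * codeBound) codeBound ⟩
      suc (g u) * codeBound        ≤⟨ *-monoˡ-≤ codeBound gu<gv ⟩
      g v * codeBound              ≤⟨ m≤m+n (g v * codeBound) (code v) ⟩
      g v * codeBound + code v     ∎
    where open ≤-Reasoning

  -- Equal refined ranks force equal codes, hence equal neighbourhoods.
  refine-injective : ∀ g u v → refine g u ≡ refine g v → u ⊆N v within G
  refine-injective g u v eq with <-cmp (g u) (g v)
  ... | tri< gu<gv _ _ = contradiction eq (<⇒≢ (refine-strict g u v gu<gv))
  ... | tri> _ _ gv<gu = contradiction (≡-sym eq) (<⇒≢ (refine-strict g v u gv<gu))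
  ... | tri≈ _ gu≡gv _ = code-injective u v
          (+-cancelˡ-≡ (g v * codeBound) (code u) (code v)
            (subst (λ x → x * codeBound + code u ≡ refine g v) gu≡gv eq))

  refine-linear : ∀ inC g → (∀ u v → u ⊆N v within G → g u ≤ g v) →
                  IsLinearExtension G inC (refine g)
  refine-linear inC g g-mono u v _ _ =
    (λ u⊆v → +-mono-≤ (*-monoˡ-≤ codeBound (g-mono u v u⊆v)) (code-mono u v u⊆v)) ,
    refine-injective g u v

module BoxRealizer {n} (G : Graph n) (inC : Fin n → Bool) (split : IsSplitPartition G inC)
  {j} (H : Fin j → Graph n) (interval : ∀ i → IsIntervalGraph (H i))
  (represents : ∀ u v → (Adj G u v → ∀ i → Adj (H i) u v)
                       × ((∀ i → Adj (H i) u v) → Adj G u v)) where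

  left right : Fin j → Fin n → ℕ
  left  i = proj₁ (interval i)
  right i = proj₁ (proj₂ (interval i))

  Overlap : Fin j → Fin n → Fin n → Set
  Overlap i u v = left i u ≤ right i v × left i v ≤ right i u

  overlap? : ∀ i u v → Dec (Overlap i u v)
  overlap? i u v = (left i u ≤? right i v) ×-dec (left i v ≤? right i u)

  overlap⇔adjacent : ∀ i u v → u ≢ v → (Adj (H i) u v → Overlap i u v)
                                       × (Overlap i u v → Adj (H i) u v)
  overlap⇔adjacent i = proj₂ (proj₂ (proj₂ (interval i)))

  adjacent⇒overlap : ∀ i {u v} → Adj G u v → Overlap i u v
  adjacent⇒overlap i {u} {v} a =
    proj₁ (overlap⇔adjacent i u v (λ { refl → irrefl G a })) (proj₁ (represents u v) a i)

  allOverlap⇒adjacent : ∀ {u v} → u ≢ v → (∀ i → Overlap i u v) → Adj G u v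
  allOverlap⇒adjacent {u} {v} u≢v ov =
    proj₂ (represents u v) (λ i → proj₂ (overlap⇔adjacent i u v u≢v) (ov i))

  adj? : Decidable (Adj G)
  adj? u v with u ≟ᶠ v
  ... | yes refl = no (irrefl G)
  ... | no u≢v with all? (λ i → overlap? i u v)
  ...   | yes ov  = yes (allOverlap⇒adjacent u≢v ov)
  ...   | no ¬ov  = no (λ a → ¬ov (λ i → adjacent⇒overlap i a))

  open Neighbourhoods G adj?

  separatingCoordinate : ∀ {v c} → v ≢ c → ¬ Adj G v c →
                         ∃ λ i → right i c < left i v ⊎ right i v < left i c
  separatingCoordinate {v} {c} v≢c ¬vc
    with ¬∀⟶∃¬ j (λ i → Overlap i v c) (λ i → overlap? i v c)
                (¬vc ∘ allOverlap⇒adjacent v≢c)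
  ... | i , ¬ov with left i v ≤? right i c | left i c ≤? right i v
  ...   | no lv≰rc | _        = i , inj₁ (≰⇒> lv≰rc)
  ...   | yes _    | no lc≰rv = i , inj₂ (≰⇒> lc≰rv)
  ...   | yes lv≤rc | yes lc≤rv = contradiction (lv≤rc , lc≤rv) ¬ov

  -- Reflecting coordinate i in the point  span i  (the largest left endpoint)
  -- sends the interval [l , r] to one whose left endpoint is  span i ∸ r.
  span : Fin j → ℕ
  span i = maxOf (left i)

  mirrored : Fin j → Fin n → ℕ
  mirrored i w = span i ∸ right i w

  ranking : Fin 2 × Fin j → Fin n → ℕ
  ranking (zero     , i) = reach (left i)
  ranking (suc zero , i) = reach (mirrored i)

  ranking-mono : ∀ p u v → u ⊆N v within G → ranking p u ≤ ranking p v
  ranking-mono (zero     , i) u v = reach-mono (left i)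
  ranking-mono (suc zero , i) u v = reach-mono (mirrored i)

  ranking-separates : ∀ {u v c} i → Adj G u c →
                      right i c < left i v ⊎ right i v < left i c →
                      ∃ λ p → ranking p v < ranking p u
  ranking-separates i uc (inj₂ rv<lc) =
    (zero , i) , reach-separates (left i) uc (λ w vw → proj₂ (adjacent⇒overlap i vw)) rv<lc
  ranking-separates {v = v} i uc (inj₁ rc<lv) =
    (suc zero , i) ,
    reach-separates (mirrored i) uc
      (λ w vw → ∸-monoʳ-≤ (span i) (proj₁ (adjacent⇒overlap i vw)))
      (∸-monoʳ-< rc<lv (≤-maxOf (left i) v))

  realizer : Fin (2 * j) → Fin n → ℕ
  realizer x = refine (ranking (remQuot j x))

  realizer-linear : ∀ x → IsLinearExtension G inC (realizer x)
  realizer-linear x = refine-linear inC (ranking (remQuot j x)) (ranking-mono (remQuot j x))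

  neighbour≢independent : ∀ {u v c} → inC u ≡ false → inC v ≡ false → Adj G u c → v ≢ c
  neighbour≢independent iu iv uc refl = IsSplitPartition.independent split _ _ iu iv uc

  separate : ∀ u v → inC u ≡ false → inC v ≡ false → ¬ (u ⊆N v within G) →
             ∃ λ x → realizer x v < realizer x u
  separate u v iu iv u⊈v =
    let (c , uc , ¬vc)       = missedNeighbour u v u⊈v
        (i , disjoint)       = separatingCoordinate (neighbour≢independent iu iv uc) ¬vc
        ((q , i') , below)   = ranking-separates i uc disjoint
    in combine q i' ,
       subst (λ p → refine (ranking p) v < refine (ranking p) u)
             (≡-sym (remQuot-combine q i'))
             (refine-strict (ranking (q , i')) v u below)

theorem3 : ∀ (n : ℕ) (G : Graph n) (inC : Fin n → Bool) →
    IsSplitPartition G inC →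
    ∀ (k : ℕ) → BoxicityAtMost G k → DimAtMost G inC (2 * k)
theorem3 n G inC split k (j , j≤k , H , interval , represents) =
  2 * j , *-monoʳ-≤ 2 j≤k , realizer , realizer-linear ,
  λ u v iu iv u⊈v v⊈u → separate v u iv iu v⊈u , separate u v iu iv u⊈v
  where open BoxRealizer G inC split H interval represents
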